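{- Let $A$ be a finite alphabet of size $m$, and let $w=\mu^{\omega}(a)$ where $\mu$ is an $r$-uniform morphism ($r\ge 2$) prolongable on $a\in A$; assume $w$ is aperiodic and uniformly recurrent. Let $t$ be a substring of $w$ such that every length-$2$ substring of $w$ is a substring of $t$. Let $s$ be a substring of $w$ with $s=ftg$ for some letters $f,g\in A$. Fix a positive integer $n$ and suppose $\mu^n(s)$ is a substring of $w$, say $\mu^n(s)=w_{[\gamma,\gamma+|s|\cdot r^n]}$ for some $\gamma\ge 0$. If $i$ is the remainder when $\gamma$ is divided by $r^n$, then $\gcd(i,r^n)>\frac{r^n}{m^2}$.
   Context: Words are indexed from $0$, and $v_{[i,j]}$ denotes the substring $v_iv_{i+1}\cdots v_{j-1}$ (from index $i$ up to but not including index $j$). A morphism $\mu$ is $r$-uniform if $|\mu(b)|=r$ for all letters $b$, prolongable on $a$ if $\mu(a)$ begins with $a$, and $\mu^{\omega}(a)$ is the infinite word having each $\mu^n(a)$ as a prefix. An infinite word is aperiodic if it has no periodic suffix; it is uniformly recurrent if for every $p$ there is $q$ such that every length-$p$ substring of $w$ occurs in every length-$q$ substring of $w$. Here $\gcd(0,r^n)=r^n$. -}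

module Defs where

open import Data.Nat using (ℕ; zero; suc; _+_; _*_; _^_; _<_; _≤_; _≥_; _>_)
open import Data.Nat.Properties using (m^n≢0)
open import Data.Nat.DivMod using (_%_)
open import Data.Fin using (Fin)
open import Data.List using (List; []; _∷_; _++_; map; upTo; concatMap; length)
open import Data.Product using (Σ; ∃; _×_; _,_)
open import Relation.Binary.PropositionalEquality using (_≡_)
open import Relation.Nullary using (¬_)

Word : ℕ → Set
Word m = ℕ → Fin m

-- w_[i, i+l] as a finite list: w_i w_{i+1} ... w_{i+l-1}.
slice : ∀ {m} → Word m → ℕ → ℕ → List (Fin m)
slice w i l = map (λ j → w (i + j)) (upTo l)

FactorOf : ∀ {m} → List (Fin m) → List (Fin m) → Set
FactorOf u t = ∃ λ xs → ∃ λ ys → xs ++ u ++ ys ≡ t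

SubstringOf : ∀ {m} → List (Fin m) → Word m → Set
SubstringOf u w = ∃ λ k → slice w k (length u) ≡ u

Morphism : ℕ → Set
Morphism m = Fin m → List (Fin m)

apply : ∀ {m} → Morphism m → List (Fin m) → List (Fin m)
apply μ = concatMap μ

applyⁿ : ∀ {m} → Morphism m → ℕ → List (Fin m) → List (Fin m)
applyⁿ μ zero u = u
applyⁿ μ (suc n) u = apply μ (applyⁿ μ n u)

Uniform : ∀ {m} → ℕ → Morphism m → Set
Uniform r μ = ∀ b → length (μ b) ≡ r

ProlongableOn : ∀ {m} → Morphism m → Fin m → Set
ProlongableOn μ a = ∃ λ u → μ a ≡ a ∷ u

-- w = μ^ω(a): w has every μ^n(a) as a prefix.
IsFixedPointFrom : ∀ {m} → Morphism m → Fin m → Word m → Set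
IsFixedPointFrom μ a w = ∀ n → slice w 0 (length (applyⁿ μ n (a ∷ []))) ≡ applyⁿ μ n (a ∷ [])

Aperiodic : ∀ {m} → Word m → Set
Aperiodic w = ¬ (∃ λ p → p > 0 × ∃ λ N → ∀ k → k ≥ N → w (k + p) ≡ w k)

UniformlyRecurrent : ∀ {m} → Word m → Set
UniformlyRecurrent w =
  ∀ p → ∃ λ q → ∀ i j → ∃ λ l → (l + p ≤ q) × (slice w (j + l) p ≡ slice w i p)

-- remainder of γ divided by r^n (r = 0 never occurs since r ≥ 2 is assumed).
remPow : ℕ → ℕ → ℕ → ℕ
remPow γ zero n = 0
remPow γ (suc r) n = _%_ γ (suc r ^ n) {{m^n≢0 (suc r) n}}

module Submission where

-- Put R = r^n, ν = μ^n, i = γ mod R and d = gcd(i, R).  Because μ is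
-- r-uniform and w = ν(w), the letters w_{QR} … w_{QR+2R-1} spell ν(w_Q w_{Q+1});
-- because w_Q w_{Q+1} occurs in t and ν(ftg) occurs at position γ, the same
-- block also occurs at a position ≡ γ (mod R).  Hence the length-R window of w at
-- any position P reappears at a position ≡ P + γ (mod R), and by iteration at a
-- position ≡ P + kγ for every k.  By Bézout some k brings the residue below d,
-- where the window is read off from ν(bc) at an offset < d, b and c letters.
-- So w has at most d·m² distinct windows of length R, while an aperiodic word
-- has more than k windows of length k (Morse–Hedlund).  Thus R < d·m².

open import Defs
open import Data.Nat using (ℕ; zero; suc; _+_; _*_; _^_; _<_; _≤_; _>_; _≥_; _∸_;
  z≤n; s≤s; NonZero; >-nonZero; ≢-nonZero; ≢-nonZero⁻¹; _<?_)
open import Data.Nat.Properties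
open import Data.Nat.DivMod using (_%_; _/_; %-distribˡ-+; m≡m%n+[m/n]*n; m%n<n; [m+kn]%n≡m%n; m<n⇒m%n≡m)
open import Data.Nat.GCD using (gcd; gcd-GCD; module Bézout; gcd[m,n]∣n; gcd[m,n]≢0; gcd[m,n]≤n)
open import Data.Nat.Divisibility using (divides)
open import Data.Nat.Tactic.RingSolver using (solve-∀)
open import Data.Fin using (Fin; toℕ; combine; remQuot; fromℕ<; punchIn; punchOut)
  renaming (_≟_ to _≟ᶠ_)
open import Data.Fin.Properties using (pigeonhole; punchIn-punchOut; remQuot-combine; toℕ-fromℕ<)
open import Data.List using (List; []; _∷_; _++_; length; map; applyUpTo)
open import Data.List.Properties using (length-++; ++-assoc; concatMap-++)
open import Data.Product using (Σ; ∃; ∃₂; _×_; _,_; proj₁; proj₂; map₂)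
open import Data.Sum using (inj₁; inj₂)
open import Data.Empty using (⊥; ⊥-elim)
open import Relation.Nullary using (¬_; yes; no)
open import Relation.Binary.PropositionalEquality

-- Finite words as lists, read letter by letter with a default beyond the end.

module _ {A : Set} (dflt : A) where

  at : List A → ℕ → A
  at []       _       = dflt
  at (x ∷ xs) zero    = x
  at (x ∷ xs) (suc j) = at xs j

  at-++ˡ : ∀ xs ys j → j < length xs → at (xs ++ ys) j ≡ at xs j
  at-++ˡ (x ∷ xs) ys zero    _       = refl
  at-++ˡ (x ∷ xs) ys (suc j) (s≤s p) = at-++ˡ xs ys j p

  at-++ʳ : ∀ xs ys j → at (xs ++ ys) (length xs + j) ≡ at ys j
  at-++ʳ []       ys j = refl
  at-++ʳ (x ∷ xs) ys j = at-++ʳ xs ys j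

  at-middle : ∀ xs b c ys →
    at (xs ++ b ∷ c ∷ ys) (length xs) ≡ b × at (xs ++ b ∷ c ∷ ys) (suc (length xs)) ≡ c
    × suc (length xs) < length (xs ++ b ∷ c ∷ ys)
  at-middle []       b c ys = refl , refl , s≤s (s≤s z≤n)
  at-middle (x ∷ xs) b c ys with at-middle xs b c ys
  ... | eb , ec , bound = eb , ec , s≤s bound

at-map-applyUpTo : ∀ {A B : Set} (dflt : B) (f : A → B) (g : ℕ → A) L j → j < L →
  at dflt (map f (applyUpTo g L)) j ≡ f (g j)
at-map-applyUpTo dflt f g (suc L) zero    _       = refl
at-map-applyUpTo dflt f g (suc L) (suc j) (s≤s p) = at-map-applyUpTo dflt f (λ x → g (suc x)) L j p

slice-at : ∀ {m} (dflt : Fin m) (w : Word m) P L u → slice w P L ≡ u →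
  ∀ j → j < L → w (P + j) ≡ at dflt u j
slice-at dflt w P L u eq j j<L =
  trans (sym (at-map-applyUpTo dflt (λ j → w (P + j)) (λ x → x) L j j<L)) (cong (λ v → at dflt v j) eq)

module _ {m : ℕ} (μ : Morphism m) where

  applyⁿ-++ : ∀ n xs ys → applyⁿ μ n (xs ++ ys) ≡ applyⁿ μ n xs ++ applyⁿ μ n ys
  applyⁿ-++ zero    xs ys = refl
  applyⁿ-++ (suc n) xs ys =
    trans (cong (apply μ) (applyⁿ-++ n xs ys)) (concatMap-++ μ (applyⁿ μ n xs) (applyⁿ μ n ys))

  applyⁿ-+ : ∀ n k xs → applyⁿ μ (n + k) xs ≡ applyⁿ μ n (applyⁿ μ k xs)
  applyⁿ-+ zero    k xs = refl
  applyⁿ-+ (suc n) k xs = cong (apply μ) (applyⁿ-+ n k xs)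

  module _ {r : ℕ} (uniform : Uniform r μ) where

    length-apply : ∀ xs → length (apply μ xs) ≡ length xs * r
    length-apply []       = refl
    length-apply (x ∷ xs) = trans (length-++ (μ x)) (cong₂ _+_ (uniform x) (length-apply xs))

    length-applyⁿ : ∀ n xs → length (applyⁿ μ n xs) ≡ length xs * r ^ n
    length-applyⁿ zero    xs = sym (*-identityʳ _)
    length-applyⁿ (suc n) xs = begin
      length (apply μ (applyⁿ μ n xs)) ≡⟨ length-apply (applyⁿ μ n xs) ⟩
      length (applyⁿ μ n xs) * r       ≡⟨ cong (_* r) (length-applyⁿ n xs) ⟩
      length xs * r ^ n * r            ≡⟨ *-assoc (length xs) (r ^ n) r ⟩
      length xs * (r ^ n * r)          ≡⟨ cong (length xs *_) (*-comm (r ^ n) r) ⟩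
      length xs * r ^ suc n            ∎
      where open ≡-Reasoning

n<r^n : ∀ {r} → 2 ≤ r → ∀ k → k < r ^ k
n<r^n r≥2 zero    = s≤s z≤n
n<r^n {r} r≥2 (suc k) = begin
  suc (suc k)   ≤⟨ s≤s (m≤n+m (suc k) k) ⟩
  suc k + suc k ≡⟨ cong (suc k +_) (sym (+-identityʳ (suc k))) ⟩
  2 * suc k     ≤⟨ *-mono-≤ r≥2 (n<r^n r≥2 k) ⟩
  r * r ^ k     ∎
  where open ≤-Reasoning

-- Windows of an infinite word, and the Morse–Hedlund bound.

module _ {m : ℕ} (w : Word m) where

  Agree : ℕ → ℕ → ℕ → Set
  Agree k P P' = ∀ z → z < k → w (P + z) ≡ w (P' + z)

  Matches : ℕ → ℕ → (ℕ → Fin m) → Set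
  Matches k P c = ∀ z → z < k → w (P + z) ≡ c z

  Covers : ℕ → (N : ℕ) → (Fin N → ℕ → Fin m) → Set
  Covers k N cand = ∀ P → ∃ λ j → Matches k P (cand j)

  Deterministic : ℕ → Set
  Deterministic k = ∀ Q Q' → Agree k Q Q' → w (Q + k) ≡ w (Q' + k)

  RightSpecial : ℕ → Set
  RightSpecial k = ∃₂ λ P P' → Agree k P P' × w (P + k) ≢ w (P' + k)

  not-special⇒deterministic : ∀ k → ¬ RightSpecial k → Deterministic k
  not-special⇒deterministic k not-special Q Q' agree with w (Q + k) ≟ᶠ w (Q' + k)
  ... | yes same = same
  ... | no differ = ⊥-elim (not-special (Q , Q' , agree , differ))

  agree-tail : ∀ {k P P'} → Agree (suc k) P P' → Agree k (suc P) (suc P')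
  agree-tail {P = P} {P'} agree z z<k =
    subst₂ (λ x y → w x ≡ w y) (+-suc P z) (+-suc P' z) (agree (suc z) (s≤s z<k))

  agree-shift : ∀ {k P P'} → Deterministic k → Agree (suc k) P P' → Agree (suc k) (suc P) (suc P')
  agree-shift det agree z z<1+k with m<1+n⇒m<n∨m≡n z<1+k
  ... | inj₁ z<k  = agree-tail agree z z<k
  ... | inj₂ refl = det _ _ (agree-tail agree)

  agree-iterate : ∀ {k P P'} → Deterministic k → Agree (suc k) P P' → ∀ t → Agree (suc k) (t + P) (t + P')
  agree-iterate det agree zero    = agree
  agree-iterate det agree (suc t) = agree-shift det (agree-iterate det agree t)

  repeat⇒periodic : ∀ {k P P'} → Deterministic k → P < P' → Agree (suc k) P P' → ¬ Aperiodic w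
  repeat⇒periodic {k} {P} {P'} det P<P' agree aperiodic =
    aperiodic (P' ∸ P , m<n⇒0<n∸m P<P' , P , periodic)
    where
    periodic : ∀ x → x ≥ P → w (x + (P' ∸ P)) ≡ w x
    periodic x P≤x = subst₂ (λ y y' → w y ≡ w y') shifted start
                       (sym (agree-iterate det agree (x ∸ P) 0 (s≤s z≤n)))
      where
      open ≡-Reasoning
      start : x ∸ P + P + 0 ≡ x
      start = trans (+-identityʳ _) (m∸n+n≡m P≤x)
      shifted : x ∸ P + P' + 0 ≡ x + (P' ∸ P)
      shifted = begin
        x ∸ P + P' + 0          ≡⟨ +-identityʳ _ ⟩
        x ∸ P + P'              ≡⟨ cong (x ∸ P +_) (sym (m+[n∸m]≡n (<⇒≤ P<P'))) ⟩
        x ∸ P + (P + (P' ∸ P))  ≡⟨ sym (+-assoc (x ∸ P) P (P' ∸ P)) ⟩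
        x ∸ P + P + (P' ∸ P)    ≡⟨ cong (_+ (P' ∸ P)) (m∸n+n≡m P≤x) ⟩
        x + (P' ∸ P)            ∎

  -- A right-special k-window separates two candidates for (k+1)-windows that
  -- agree below k; deleting one of them leaves a cover of the k-windows.
  drop-candidate : ∀ {k N} (cand : Fin (suc N) → ℕ → Fin m) → Covers (suc k) (suc N) cand →
    RightSpecial k → Σ (Fin N → ℕ → Fin m) (Covers k N)
  drop-candidate {k} {N} cand cover (P , P' , agree , differ) with cover P | cover P'
  ... | j , matchP | j' , matchP' = (λ l → cand (punchIn j' l)) , cover'
    where
    j'≢j : j' ≢ j
    j'≢j refl = differ (trans (matchP k ≤-refl) (sym (matchP' k ≤-refl)))
    same-prefix : ∀ z → z < k → cand j' z ≡ cand j z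
    same-prefix z z<k = trans (sym (matchP' z (m<n⇒m<1+n z<k)))
                          (trans (sym (agree z z<k)) (matchP z (m<n⇒m<1+n z<k)))
    cover' : Covers k N (λ l → cand (punchIn j' l))
    cover' Q with cover Q
    ... | l , matchQ with j' ≟ᶠ l
    ...   | no j'≢l  = punchOut j'≢l , λ z z<k →
            trans (matchQ z (m<n⇒m<1+n z<k)) (cong (λ x → cand x z) (sym (punchIn-punchOut j'≢l)))
    ...   | yes refl = punchOut j'≢j , λ z z<k →
            trans (matchQ z (m<n⇒m<1+n z<k))
              (trans (same-prefix z z<k) (cong (λ x → cand x z) (sym (punchIn-punchOut j'≢j))))

  -- Induction on k: a right-special (k-1)-window lets us drop a candidate;
  -- otherwise two of the windows at 0 … k share a candidate, forcing periodicity.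
  morse-hedlund : Aperiodic w → ∀ k N (cand : Fin N → ℕ → Fin m) → Covers k N cand → k < N
  morse-hedlund aperiodic k N cand cover = ≰⇒> (few-windows k N cand cover)
    where
    few-windows : ∀ k N (cand : Fin N → ℕ → Fin m) → Covers k N cand → ¬ (N ≤ k)
    few-windows k zero cand cover _ with cover 0
    ... | () , _
    few-windows zero (suc N) cand cover ()
    few-windows (suc k) (suc N) cand cover (s≤s N≤k) =
      repeated (not-special⇒deterministic k λ special →
        few-windows k N (proj₁ (drop-candidate cand cover special))
                        (proj₂ (drop-candidate cand cover special)) N≤k)
      where
      repeated : Deterministic k → ⊥
      repeated det with pigeonhole (s≤s (s≤s N≤k)) (λ (p : Fin (suc (suc k))) → proj₁ (cover (toℕ p)))
      ... | p , q , p<q , same = repeat⇒periodic det p<q agree aperiodic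
        where
        agree : Agree (suc k) (toℕ p) (toℕ q)
        agree z z<1+k = trans (proj₂ (cover (toℕ p)) z z<1+k)
          (trans (cong (λ j → cand j z) same) (sym (proj₂ (cover (toℕ q)) z z<1+k)))

bézout-negative : ∀ i R .{{_ : NonZero R}} → ∃₂ λ u Y → gcd i R + u * i ≡ Y * R
bézout-negative i R with Bézout.identity (gcd-GCD i R) | gcd[m,n]∣n i R
... | Bézout.-+ x y eq | _                  = x , y , eq
... | Bézout.+- x y eq | divides zero R≡0   = ⊥-elim (≢-nonZero⁻¹ R R≡0)
... | Bézout.+- x y eq | divides (suc q) R≡ = q * x , suc (q * y) , (begin
    d + q * x * i         ≡⟨ cong (d +_) (*-assoc q x i) ⟩
    d + q * (x * i)       ≡⟨ cong (λ v → d + q * v) (sym eq) ⟩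
    d + q * (d + y * R)   ≡⟨ expand d q y R ⟩
    suc q * d + q * y * R ≡⟨ cong (_+ q * y * R) (sym R≡) ⟩
    R + q * y * R         ∎)
  where
  open ≡-Reasoning
  d : ℕ
  d = gcd i R
  expand : ∀ d q y R → d + q * (d + y * R) ≡ suc q * d + q * y * R
  expand = solve-∀

residue-reduction : ∀ c R .{{_ : NonZero R}} P → ∃ λ k → (P + k * c) % R < gcd (c % R) R
residue-reduction c R P with bézout-negative (c % R) R
... | u , Y , bézout = k , (begin-strict
    (P + k * c) % R                              ≡⟨ cong (_% R) decomposition ⟩
    (P % d + (P / d * Y + k * (c / R)) * R) % R  ≡⟨ [m+kn]%n≡m%n (P % d) (P / d * Y + k * (c / R)) R ⟩
    P % d % R                                    ≡⟨ m<n⇒m%n≡m (<-≤-trans (m%n<n P d) (gcd[m,n]≤n i R)) ⟩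
    P % d                                        <⟨ m%n<n P d ⟩
    d                                            ∎)
  where
  open ≤-Reasoning
  i d : ℕ
  i = c % R
  d = gcd i R
  instance
    d≢0 : NonZero d
    d≢0 = ≢-nonZero (gcd[m,n]≢0 i R (inj₂ (≢-nonZero⁻¹ R)))
  k : ℕ
  k = P / d * u
  regroup₁ : ∀ e a d u i q R → e + a * d + a * u * (i + q * R) ≡ e + a * (d + u * i) + a * u * q * R
  regroup₁ = solve-∀
  regroup₂ : ∀ e a Y k q R → e + a * (Y * R) + k * q * R ≡ e + (a * Y + k * q) * R
  regroup₂ = solve-∀
  decomposition : P + k * c ≡ P % d + (P / d * Y + k * (c / R)) * R
  decomposition = ≡.begin
    P + k * c                                         ≡.≡⟨ cong₂ (λ p c′ → p + k * c′) (m≡m%n+[m/n]*n P d) (m≡m%n+[m/n]*n c R) ⟩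
    P % d + P / d * d + P / d * u * (i + c / R * R)   ≡.≡⟨ regroup₁ (P % d) (P / d) d u i (c / R) R ⟩
    P % d + P / d * (d + u * i) + k * (c / R) * R     ≡.≡⟨ cong (λ v → P % d + P / d * v + k * (c / R) * R) bézout ⟩
    P % d + P / d * (Y * R) + k * (c / R) * R         ≡.≡⟨ regroup₂ (P % d) (P / d) Y k (c / R) R ⟩
    P % d + (P / d * Y + k * (c / R)) * R             ≡.∎
    where module ≡ = ≡-Reasoning

+-cong-% : ∀ {a b} c R .{{_ : NonZero R}} → a % R ≡ b % R → (a + c) % R ≡ (b + c) % R
+-cong-% {a} {b} c R a≡b = begin
  (a + c) % R             ≡⟨ %-distribˡ-+ a c R ⟩
  (a % R + c % R) % R     ≡⟨ cong (λ x → (x + c % R) % R) a≡b ⟩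
  (b % R + c % R) % R     ≡⟨ sym (%-distribˡ-+ b c R) ⟩
  (b + c) % R             ∎
  where open ≡-Reasoning

module UniformImage {m : ℕ} (μ : Morphism m) {r : ℕ} (uniform : Uniform r μ) (n : ℕ) (dflt : Fin m) where

  R : ℕ
  R = r ^ n

  ν : List (Fin m) → List (Fin m)
  ν = applyⁿ μ n

  pairBlock : Fin m → Fin m → ℕ → Fin m
  pairBlock b c = at dflt (ν (b ∷ c ∷ []))

  length-ν-letter : ∀ b → length (ν (b ∷ [])) ≡ R
  length-ν-letter b = trans (length-applyⁿ μ uniform n (b ∷ [])) (*-identityˡ R)

  block-bound : ∀ j y L → suc j < L → y < R + R → j * R + y < L * R
  block-bound j y L j+1<L y<2R = begin-strict
    j * R + y         <⟨ +-monoʳ-< (j * R) y<2R ⟩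
    j * R + (R + R)   ≡⟨ regroup j R ⟩
    suc (suc j) * R   ≤⟨ *-monoˡ-≤ R j+1<L ⟩
    L * R             ∎
    where
    open ≤-Reasoning
    regroup : ∀ j R → j * R + (R + R) ≡ suc (suc j) * R
    regroup = solve-∀

  at-ν-letter : ∀ u j x → j < length u → x < R →
    at dflt (ν u) (j * R + x) ≡ at dflt (ν (at dflt u j ∷ [])) x
  at-ν-letter (b ∷ u) zero x _ x<R =
    trans (cong (λ l → at dflt l x) (applyⁿ-++ μ n (b ∷ []) u))
          (at-++ˡ dflt (ν (b ∷ [])) (ν u) x (subst (x <_) (sym (length-ν-letter b)) x<R))
  at-ν-letter (b ∷ u) (suc j) x (s≤s j<|u|) x<R = begin
    at dflt (ν (b ∷ u)) (suc j * R + x)                        ≡⟨ cong (λ l → at dflt l (suc j * R + x)) (applyⁿ-++ μ n (b ∷ []) u) ⟩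
    at dflt (νb ++ ν u) (R + j * R + x)                        ≡⟨ cong (at dflt (νb ++ ν u)) skip-first ⟩
    at dflt (νb ++ ν u) (length νb + (j * R + x))              ≡⟨ at-++ʳ dflt νb (ν u) (j * R + x) ⟩
    at dflt (ν u) (j * R + x)                                  ≡⟨ at-ν-letter u j x j<|u| x<R ⟩
    at dflt (ν (at dflt u j ∷ [])) x                           ∎
    where
    open ≡-Reasoning
    νb : List (Fin m)
    νb = ν (b ∷ [])
    skip-first : R + j * R + x ≡ length νb + (j * R + x)
    skip-first = trans (+-assoc R (j * R) x) (cong (_+ (j * R + x)) (sym (length-ν-letter b)))

  at-ν-pair : ∀ u j y → suc j < length u → y < R + R →
    at dflt (ν u) (j * R + y) ≡ pairBlock (at dflt u j) (at dflt u (suc j)) y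
  at-ν-pair u j y j+1<|u| y<2R with y <? R
  ... | yes y<R = trans (at-ν-letter u j y (<-trans (n<1+n j) j+1<|u|) y<R)
                        (sym (at-ν-letter (b ∷ c ∷ []) 0 y (s≤s z≤n) y<R))
    where
    b c : Fin m
    b = at dflt u j
    c = at dflt u (suc j)
  ... | no y≮R = begin
    at dflt (ν u) (j * R + y)              ≡⟨ cong (at dflt (ν u)) (next-block j) ⟩
    at dflt (ν u) (suc j * R + y′)         ≡⟨ at-ν-letter u (suc j) y′ j+1<|u| y′<R ⟩
    at dflt (ν (c ∷ [])) y′                ≡⟨ sym (at-ν-letter (b ∷ c ∷ []) 1 y′ (s≤s (s≤s z≤n)) y′<R) ⟩
    at dflt (ν (b ∷ c ∷ [])) (1 * R + y′)  ≡⟨ cong (at dflt (ν (b ∷ c ∷ []))) (sym (next-block 0)) ⟩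
    pairBlock b c y                        ∎
    where
    open ≡-Reasoning
    b c : Fin m
    b = at dflt u j
    c = at dflt u (suc j)
    y′ : ℕ
    y′ = y ∸ R
    R+y′≡y : R + y′ ≡ y
    R+y′≡y = m+[n∸m]≡n (≮⇒≥ y≮R)
    y′<R : y′ < R
    y′<R = +-cancelˡ-< R y′ R (subst (_< R + R) (sym R+y′≡y) y<2R)
    regroup : ∀ k R y′ → k * R + (R + y′) ≡ suc k * R + y′
    regroup = solve-∀
    next-block : ∀ k → k * R + y ≡ suc k * R + y′
    next-block k = trans (cong (k * R +_) (sym R+y′≡y)) (regroup k R y′)

module Windows {m : ℕ} (μ : Morphism m) {r : ℕ} (uniform : Uniform r μ) (n : ℕ) (r≥2 : 2 ≤ r)
               (a : Fin m) (w : Word m) (fixed : IsFixedPointFrom μ a w) where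

  open UniformImage μ uniform n a

  instance
    r≢0 : NonZero r
    r≢0 = >-nonZero (<-≤-trans (s≤s z≤n) r≥2)
    R≢0 : NonZero R
    R≢0 = m^n≢0 r n

  prefix-at : ∀ k p → p < length (applyⁿ μ k (a ∷ [])) → w p ≡ at a (applyⁿ μ k (a ∷ [])) p
  prefix-at k p = slice-at a w 0 _ _ (fixed k) p

  position-split : ∀ P z → P + z ≡ P / R * R + (P % R + z)
  position-split P z = trans (cong (_+ z) (m≡m%n+[m/n]*n P R)) (regroup (P % R) (P / R) R z)
    where
    regroup : ∀ e q R z → e + q * R + z ≡ q * R + (e + z)
    regroup = solve-∀

  -- As w = ν(w), the letters in [QR, QR + 2R) spell ν(w_Q w_{Q+1}).
  fixed-point-blocks : ∀ Q y → y < R + R → w (Q * R + y) ≡ pairBlock (w Q) (w (suc Q)) y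
  fixed-point-blocks Q y y<2R = begin
    w (Q * R + y)                                       ≡⟨ prefix-at (n + suc Q) (Q * R + y) inside ⟩
    at a (applyⁿ μ (n + suc Q) (a ∷ [])) (Q * R + y)    ≡⟨ cong (λ l → at a l (Q * R + y)) (applyⁿ-+ μ n (suc Q) (a ∷ [])) ⟩
    at a (ν V) (Q * R + y)                              ≡⟨ at-ν-pair V Q y Q+1<|V| y<2R ⟩
    pairBlock (at a V Q) (at a V (suc Q)) y             ≡⟨ cong₂ (λ b c → pairBlock b c y) (sym (prefix-at (suc Q) Q (<-trans (n<1+n Q) Q+1<|V|)))
                                                                                          (sym (prefix-at (suc Q) (suc Q) Q+1<|V|)) ⟩
    pairBlock (w Q) (w (suc Q)) y                       ∎
    where
    open ≡-Reasoning
    V : List (Fin m)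
    V = applyⁿ μ (suc Q) (a ∷ [])
    Q+1<|V| : suc Q < length V
    Q+1<|V| = subst (suc Q <_) (sym (trans (length-applyⁿ μ uniform (suc Q) (a ∷ [])) (*-identityˡ _)))
                    (n<r^n r≥2 (suc Q))
    inside : Q * R + y < length (applyⁿ μ (n + suc Q) (a ∷ []))
    inside = subst (Q * R + y <_)
               (sym (trans (cong length (applyⁿ-+ μ n (suc Q) (a ∷ []))) (length-applyⁿ μ uniform n V)))
               (block-bound Q y (length V) Q+1<|V| y<2R)

  occurrence-pair : ∀ P u j → slice w P (length u * R) ≡ ν u → suc j < length u →
    ∀ y → y < R + R → w (P + (j * R + y)) ≡ pairBlock (at a u j) (at a u (suc j)) y
  occurrence-pair P u j occ j+1<|u| y y<2R =
    trans (slice-at a w P _ _ occ (j * R + y) (block-bound j y (length u) j+1<|u| y<2R))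
          (at-ν-pair u j y j+1<|u| y<2R)

  -- Each w_Q w_{Q+1} occurs in t, so ν(w_Q w_{Q+1}) occurs inside ν(ftg) at γ.
  occurrence-blocks : ∀ γ t f g → slice w γ (length (f ∷ (t ++ g ∷ [])) * R) ≡ ν (f ∷ (t ++ g ∷ [])) →
    (∀ i → FactorOf (slice w i 2) t) →
    ∀ Q → ∃ λ J → ∀ y → y < R + R → w (γ + (J * R + y)) ≡ pairBlock (w Q) (w (suc Q)) y
  occurrence-blocks γ t f g occ factors Q with factors Q
  ... | xs , ys , refl with at-middle a (f ∷ xs) (w (Q + 0)) (w (Q + 1)) (ys ++ g ∷ [])
  ... | at-b , at-c , J+1<|u| = suc (length xs) , λ y y<2R → begin
    w (γ + (suc (length xs) * R + y))                                ≡⟨ occurrence-pair γ u (suc (length xs)) occ′ J+1<|u| y y<2R ⟩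
    pairBlock (at a u (suc (length xs))) (at a u (suc (suc (length xs)))) y
                                                                     ≡⟨ cong₂ (λ b c → pairBlock b c y) (trans at-b (cong w (+-identityʳ Q)))
                                                                                                         (trans at-c (cong w (+-comm Q 1))) ⟩
    pairBlock (w Q) (w (suc Q)) y                                    ∎
    where
    open ≡-Reasoning
    u : List (Fin m)
    u = f ∷ xs ++ w (Q + 0) ∷ w (Q + 1) ∷ ys ++ g ∷ []
    occ′ : slice w γ (length u * R) ≡ ν u
    occ′ = subst (λ v → slice w γ (length v * R) ≡ ν v)
                 (cong (f ∷_) (++-assoc xs (w (Q + 0) ∷ w (Q + 1) ∷ ys) (g ∷ []))) occ

  module _ (γ : ℕ) (t : List (Fin m)) (f g : Fin m)
           (occ : slice w γ (length (f ∷ (t ++ g ∷ [])) * R) ≡ ν (f ∷ (t ++ g ∷ [])))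
           (factors : ∀ i → FactorOf (slice w i 2) t) where

    window-shift : ∀ P → ∃ λ P′ → Agree w R P P′ × P′ % R ≡ (P + γ) % R
    window-shift P with occurrence-blocks γ t f g occ factors (P / R)
    ... | J , found = γ + (J * R + e) , agree , residue
      where
      open ≡-Reasoning
      e Q : ℕ
      e = P % R
      Q = P / R
      agree : Agree w R P (γ + (J * R + e))
      agree z z<R = begin
        w (P + z)                              ≡⟨ cong w (position-split P z) ⟩
        w (Q * R + (e + z))                    ≡⟨ fixed-point-blocks Q (e + z) e+z<2R ⟩
        pairBlock (w Q) (w (suc Q)) (e + z)    ≡⟨ sym (found (e + z) e+z<2R) ⟩
        w (γ + (J * R + (e + z)))              ≡⟨ cong w (regroup γ (J * R) e z) ⟩
        w (γ + (J * R + e) + z)                ∎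
        where
        e+z<2R : e + z < R + R
        e+z<2R = +-mono-< (m%n<n P R) z<R
        regroup : ∀ γ x e z → γ + (x + (e + z)) ≡ γ + (x + e) + z
        regroup = solve-∀
      regroup₁ : ∀ γ J R e → γ + (J * R + e) ≡ γ + e + J * R
      regroup₁ = solve-∀
      regroup₂ : ∀ γ e Q R → γ + e + Q * R ≡ e + Q * R + γ
      regroup₂ = solve-∀
      residue : (γ + (J * R + e)) % R ≡ (P + γ) % R
      residue = begin
        (γ + (J * R + e)) % R   ≡⟨ cong (_% R) (regroup₁ γ J R e) ⟩
        (γ + e + J * R) % R     ≡⟨ [m+kn]%n≡m%n (γ + e) J R ⟩
        (γ + e) % R             ≡⟨ sym ([m+kn]%n≡m%n (γ + e) Q R) ⟩
        (γ + e + Q * R) % R     ≡⟨ cong (_% R) (trans (regroup₂ γ e Q R) (cong (_+ γ) (sym (m≡m%n+[m/n]*n P R)))) ⟩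
        (P + γ) % R             ∎

    window-shift-iterate : ∀ k P → ∃ λ P′ → Agree w R P P′ × P′ % R ≡ (P + k * γ) % R
    window-shift-iterate zero    P = P , (λ _ _ → refl) , cong (_% R) (sym (+-identityʳ P))
    window-shift-iterate (suc k) P with window-shift-iterate k P
    ... | P₁ , agree₁ , residue₁ with window-shift P₁
    ... | P₂ , agree₂ , residue₂ = P₂ , (λ z z<R → trans (agree₁ z z<R) (agree₂ z z<R)) , (begin
      P₂ % R                ≡⟨ residue₂ ⟩
      (P₁ + γ) % R          ≡⟨ +-cong-% γ R residue₁ ⟩
      (P + k * γ + γ) % R   ≡⟨ cong (_% R) (regroup P k γ) ⟩
      (P + suc k * γ) % R   ∎)
      where
      open ≡-Reasoning
      regroup : ∀ P k γ → P + k * γ + γ ≡ P + suc k * γ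
      regroup = solve-∀

    d : ℕ
    d = gcd (γ % R) R

    window-representative : ∀ P → ∃ λ P′ → Agree w R P P′ × P′ % R < d
    window-representative P =
      let (k , small) = residue-reduction γ R P
          (P′ , agree , residue) = window-shift-iterate k P
      in P′ , agree , subst (_< d) (sym residue) small

    candidate : Fin d × Fin m × Fin m → ℕ → Fin m
    candidate (e , b , c) z = pairBlock b c (toℕ e + z)

    decode : Fin (d * (m * m)) → Fin d × Fin m × Fin m
    decode j = map₂ (remQuot m) (remQuot (m * m) j)

    decode-combine : ∀ e b c → decode (combine e (combine b c)) ≡ (e , b , c)
    decode-combine e b c = trans (cong (map₂ (remQuot m)) (remQuot-combine {d} e (combine b c)))
                                 (cong (e ,_) (remQuot-combine {m} b c))

    window-candidate : Fin (d * (m * m)) → ℕ → Fin m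
    window-candidate j = candidate (decode j)

    windows-covered : Covers w R (d * (m * m)) window-candidate
    windows-covered P = combine (fromℕ< e<d) (combine (w Q′) (w (suc Q′))) , λ z z<R → begin
      w (P + z)                                             ≡⟨ agree z z<R ⟩
      w (P′ + z)                                            ≡⟨ cong w (position-split P′ z) ⟩
      w (Q′ * R + (e + z))                                  ≡⟨ fixed-point-blocks Q′ (e + z) (+-mono-< (m%n<n P′ R) z<R) ⟩
      pairBlock (w Q′) (w (suc Q′)) (e + z)                 ≡⟨ cong (λ x → pairBlock (w Q′) (w (suc Q′)) (x + z)) (sym (toℕ-fromℕ< e<d)) ⟩
      candidate (fromℕ< e<d , w Q′ , w (suc Q′)) z          ≡⟨ cong (λ x → candidate x z) (sym (decode-combine (fromℕ< e<d) (w Q′) (w (suc Q′)))) ⟩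
      window-candidate (combine (fromℕ< e<d) (combine (w Q′) (w (suc Q′)))) z ∎
      where
      open ≡-Reasoning
      P′ : ℕ
      P′ = proj₁ (window-representative P)
      agree : Agree w R P P′
      agree = proj₁ (proj₂ (window-representative P))
      e<d : P′ % R < d
      e<d = proj₂ (proj₂ (window-representative P))
      e Q′ : ℕ
      e = P′ % R
      Q′ = P′ / R

    window-bound : Aperiodic w → R < d * (m * m)
    window-bound aperiodic = morse-hedlund w aperiodic R (d * (m * m)) window-candidate windows-covered

lemma8 : (m r : ℕ) → 2 ≤ r → (μ : Morphism m) → Uniform r μ → (a : Fin m) → ProlongableOn μ a
    → (w : Word m) → IsFixedPointFrom μ a w → Aperiodic w → UniformlyRecurrent w
    → (t : List (Fin m)) → SubstringOf t w → (∀ i → FactorOf (slice w i 2) t)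
    → (f g : Fin m) → SubstringOf (f ∷ (t ++ (g ∷ []))) w
    → (n : ℕ) → n > 0 → (γ : ℕ)
    → slice w γ (length (f ∷ (t ++ (g ∷ []))) * r ^ n) ≡ applyⁿ μ n (f ∷ (t ++ (g ∷ [])))
    → r ^ n < gcd (remPow γ r n) (r ^ n) * (m * m)
lemma8 m (suc (suc r)) r≥2@(s≤s (s≤s z≤n)) μ uniform a _ w fixed aperiodic _ t _ factors f g _ n _ γ occ =
  Windows.window-bound μ uniform n r≥2 a w fixed γ t f g occ factors aperiodic
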